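{- Let $P$ be a poset. Then: (1) $P$ is a lexicographical sum $\sum_{i\in D} C_i$ of chains $C_i$ indexed by a poset $D$ in which no nontrivial module is totally ordered; (2) if every module of $P$ distinct from $P$ is totally ordered, then $D$ is prime.
   Context: A module of a poset $(V,\le)$ is a set $A\subseteq V$ such that every $v\in V\setminus A$ is below all, above all, or incomparable to all elements of $A$; modules $\emptyset$, singletons and $V$ are trivial; a poset is prime if all its modules are trivial. For a poset $D$ and pairwise disjoint posets $C_i$ ($i\in D$), the lexicographical sum $\sum_{i\in D}C_i$ is the union of the $C_i$ ordered by $x\le y$ iff $x,y\in C_i$ and $x\le y$ in $C_i$, or $x\in C_i$, $y\in C_j$ with $i<j$ in $D$. -}

module Defs where

open import Level using (Level; _⊔_)
open import Data.Bool using (Bool; true; false)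
open import Data.Product using (Σ; _×_; _,_; ∃)
open import Data.Sum using (_⊎_)
open import Relation.Nullary using (¬_)
open import Relation.Binary.PropositionalEquality using (_≡_)
open import Relation.Binary.Bundles using (Poset)
open import Function.Bundles using (_⇔_)

module _ {c ℓ₁ ℓ₂ : Level} (P : Poset c ℓ₁ ℓ₂) where
  open Poset P

  Subset : Set c
  Subset = Carrier → Bool

  _∈_ : Carrier → Subset → Set
  x ∈ A = A x ≡ true

  _∉_ : Carrier → Subset → Set
  x ∉ A = A x ≡ false

  RespectsEq : Subset → Set (c ⊔ ℓ₁)
  RespectsEq A = ∀ x y → x ≈ y → A x ≡ A y

  UniformTo : Carrier → Subset → Set (c ⊔ ℓ₂)
  UniformTo v A =
      (∀ a → a ∈ A → v ≤ a)
    ⊎ (∀ a → a ∈ A → a ≤ v)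
    ⊎ (∀ a → a ∈ A → ¬ (v ≤ a) × ¬ (a ≤ v))

  IsModule : Subset → Set (c ⊔ ℓ₁ ⊔ ℓ₂)
  IsModule A = RespectsEq A × (∀ v → v ∉ A → UniformTo v A)

  IsTrivial : Subset → Set (c ⊔ ℓ₁)
  IsTrivial A =
      (∀ x → x ∉ A)
    ⊎ (Σ Carrier λ x → x ∈ A × (∀ y → y ∈ A → y ≈ x))
    ⊎ (∀ x → x ∈ A)

  IsPrime : Set (c ⊔ ℓ₁ ⊔ ℓ₂)
  IsPrime = ∀ A → IsModule A → IsTrivial A

  TotallyOrdered : Subset → Set (c ⊔ ℓ₂)
  TotallyOrdered A = ∀ x y → x ∈ A → y ∈ A → x ≤ y ⊎ y ≤ x

  ProperModulesTotallyOrdered : Set (c ⊔ ℓ₁ ⊔ ℓ₂)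
  ProperModulesTotallyOrdered =
    ∀ A → IsModule A → ¬ (∀ x → x ∈ A) → TotallyOrdered A

  NoNontrivialChainModule : Set (c ⊔ ℓ₁ ⊔ ℓ₂)
  NoNontrivialChainModule =
    ∀ A → IsModule A → ¬ IsTrivial A → ¬ TotallyOrdered A

-- P is the lexicographical sum Σ_{i∈D} C_i of nonempty chains C_i, where
-- C_i is the fibre of π over i (with the order induced from P).
record IsLexSumOfChains {c ℓ₁ ℓ₂ d e₁ e₂ : Level}
         (P : Poset c ℓ₁ ℓ₂) (D : Poset d e₁ e₂)
         : Set (c ⊔ ℓ₁ ⊔ ℓ₂ ⊔ d ⊔ e₁ ⊔ e₂) where
  module P = Poset P
  module D = Poset D
  field
    π        : P.Carrier → D.Carrier
    π-cong   : ∀ x y → x P.≈ y → π x D.≈ π y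
    nonempty : ∀ i → Σ P.Carrier λ x → π x D.≈ i
    chain    : ∀ x y → π x D.≈ π y → x P.≤ y ⊎ y P.≤ x
    across   : ∀ x y → ¬ (π x D.≈ π y) → (x P.≤ y ⇔ π x D.≤ π y)

-- Call x and y related when some totally ordered module contains both.  Two
-- chain modules sharing a point have a chain module as union, so this is an
-- equivalence relation; its classes are the chains C_i, and the quotient D,
-- ordered by x ≤ y on representatives of distinct classes, exhibits P as
-- their lexicographical sum.  The preimage of a module of D is a module of P,
-- and the preimage of a chain of D is a chain of P, hence a chain module that
-- lies inside one class: so a chain module of D has at most one element.  If
-- the proper modules of P are chains, the same argument applies to every
-- proper module of D, which is therefore trivial.
module Submission where

open import Defs
open import Level using (Level; _⊔_; Lift; lift; lower)
open import Data.Bool using (true; false; _∨_)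
open import Data.Bool.Properties using (∨-zeroʳ; ∨-conicalˡ; ∨-conicalʳ; ¬-not)
open import Data.Product using (Σ; _×_; _,_; proj₁; proj₂)
open import Data.Sum using (_⊎_; inj₁; inj₂; [_,_]′; swap)
open import Data.Empty using (⊥; ⊥-elim)
open import Function using (_∘_)
open import Relation.Nullary using (¬_; yes; no; does)
open import Relation.Binary.PropositionalEquality as ≡ using (_≡_; refl; cong₂)
open import Relation.Binary.Bundles using (Poset)
open import Function.Bundles using (mk⇔; module Equivalence)
open import Axiom.ExcludedMiddle using (ExcludedMiddle)

∨≡true⇒ : ∀ {a b} → a ∨ b ≡ true → a ≡ true ⊎ b ≡ true
∨≡true⇒ {true}  _   = inj₁ ≡.refl
∨≡true⇒ {false} b≡t = inj₂ b≡t

true≢false : ∀ {b} → b ≡ true → b ≡ false → ⊥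
true≢false refl ()

module ModuleProperties {c ℓ₁ ℓ₂ : Level} (P : Poset c ℓ₁ ℓ₂) where
  open Poset P hiding (refl)

  module _ {A : Subset P} (isModule : IsModule P A) {v y : Carrier}
           (v∉A : A v ≡ false) (y∈A : A y ≡ true) where

    ≈-member-absurd : v ≈ y → ⊥
    ≈-member-absurd v≈y = true≢false (≡.trans (proj₁ isModule v y v≈y) y∈A) v∉A

    below-module : v ≤ y → ∀ a → A a ≡ true → v ≤ a
    below-module v≤y with proj₂ isModule v v∉A
    ... | inj₁ below        = below
    ... | inj₂ (inj₁ above) = ⊥-elim (≈-member-absurd (antisym v≤y (above y y∈A)))
    ... | inj₂ (inj₂ apart) = ⊥-elim (proj₁ (apart y y∈A) v≤y)

    above-module : y ≤ v → ∀ a → A a ≡ true → a ≤ v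
    above-module y≤v with proj₂ isModule v v∉A
    ... | inj₁ below        = ⊥-elim (≈-member-absurd (antisym (below y y∈A) y≤v))
    ... | inj₂ (inj₁ above) = above
    ... | inj₂ (inj₂ apart) = ⊥-elim (proj₂ (apart y y∈A) y≤v)

    incomparable-module : ¬ v ≤ y → ¬ y ≤ v → ∀ a → A a ≡ true → ¬ v ≤ a × ¬ a ≤ v
    incomparable-module v≰y y≰v with proj₂ isModule v v∉A
    ... | inj₁ below        = ⊥-elim (v≰y (below y y∈A))
    ... | inj₂ (inj₁ above) = ⊥-elim (y≰v (above y y∈A))
    ... | inj₂ (inj₂ apart) = apart

  _∪_ : Subset P → Subset P → Subset P
  (A ∪ B) v = A v ∨ B v

  module _ (em : ∀ {a} → ExcludedMiddle a) {A B : Subset P} {y : Carrier}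
           (y∈A : A y ≡ true) (y∈B : B y ≡ true) where

    ∪-isModule : IsModule P A → IsModule P B → IsModule P (A ∪ B)
    ∪-isModule modA modB = respects , λ v v∉ → uniform (∨-conicalˡ _ _ v∉) (∨-conicalʳ _ _ v∉)
      where
      respects : RespectsEq P (A ∪ B)
      respects x z x≈z = cong₂ _∨_ (proj₁ modA x z x≈z) (proj₁ modB x z x≈z)

      uniform : ∀ {v} → A v ≡ false → B v ≡ false → UniformTo P v (A ∪ B)
      uniform {v} v∉A v∉B with em {P = v ≤ y} | em {P = y ≤ v}
      ... | yes v≤y | _ = inj₁ λ a →
        [ below-module modA v∉A y∈A v≤y a , below-module modB v∉B y∈B v≤y a ]′ ∘ ∨≡true⇒
      ... | no _ | yes y≤v = inj₂ (inj₁ λ a →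
        [ above-module modA v∉A y∈A y≤v a , above-module modB v∉B y∈B y≤v a ]′ ∘ ∨≡true⇒)
      ... | no v≰y | no y≰v = inj₂ (inj₂ λ a →
        [ incomparable-module modA v∉A y∈A v≰y y≰v a
        , incomparable-module modB v∉B y∈B v≰y y≰v a ]′ ∘ ∨≡true⇒)

    module _ (modA : IsModule P A) (totA : TotallyOrdered P A) (totB : TotallyOrdered P B) where

      comparable-across : ∀ {a b} → A a ≡ true → B b ≡ true → a ≤ b ⊎ b ≤ a
      comparable-across {a} {b} a∈A b∈B with em {P = A b ≡ true}
      ... | yes b∈A = totA a b a∈A b∈A
      ... | no b∉A with totB b y b∈B y∈B
      ...   | inj₁ b≤y = inj₂ (below-module modA (¬-not b∉A) y∈A b≤y a a∈A)
      ...   | inj₂ y≤b = inj₁ (above-module modA (¬-not b∉A) y∈A y≤b a a∈A)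

      ∪-totallyOrdered : TotallyOrdered P (A ∪ B)
      ∪-totallyOrdered x z x∈ z∈ with ∨≡true⇒ {A x} x∈ | ∨≡true⇒ {A z} z∈
      ... | inj₁ x∈A | inj₁ z∈A = totA x z x∈A z∈A
      ... | inj₂ x∈B | inj₂ z∈B = totB x z x∈B z∈B
      ... | inj₁ x∈A | inj₂ z∈B = comparable-across x∈A z∈B
      ... | inj₂ x∈B | inj₁ z∈A = swap (comparable-across z∈A x∈B)

module LexSumPreimage {c ℓ₁ ℓ₂ d e₁ e₂ : Level} {P : Poset c ℓ₁ ℓ₂} {D : Poset d e₁ e₂}
                      (lexSum : IsLexSumOfChains P D) where
  open IsLexSumOfChains lexSum

  preimage : Subset D → Subset P
  preimage B = B ∘ π

  preimage-isModule : ∀ {B} → IsModule D B → IsModule P (preimage B)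
  preimage-isModule {B} (respects , uniform) =
    (λ x y x≈y → respects (π x) (π y) (π-cong x y x≈y)) , uniformP
    where
    apart : ∀ {v a} → B (π v) ≡ false → B (π a) ≡ true → ¬ π v D.≈ π a
    apart v∉ a∈ πv≈πa = true≢false (≡.trans (respects _ _ πv≈πa) a∈) v∉

    uniformP : ∀ v → B (π v) ≡ false → UniformTo P v (preimage B)
    uniformP v v∉ with uniform (π v) v∉
    ... | inj₁ below = inj₁ λ a a∈ →
      Equivalence.from (across v a (apart v∉ a∈)) (below (π a) a∈)
    ... | inj₂ (inj₁ above) = inj₂ (inj₁ λ a a∈ →
      Equivalence.from (across a v (apart v∉ a∈ ∘ D.Eq.sym)) (above (π a) a∈))
    ... | inj₂ (inj₂ incomparable) = inj₂ (inj₂ λ a a∈ →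
      let (πv≰πa , πa≰πv) = incomparable (π a) a∈ in
      πv≰πa ∘ Equivalence.to (across v a (apart v∉ a∈)) ,
      πa≰πv ∘ Equivalence.to (across a v (apart v∉ a∈ ∘ D.Eq.sym)))

  preimage-totallyOrdered : (em : ∀ {a} → ExcludedMiddle a) →
    ∀ {B} → TotallyOrdered D B → TotallyOrdered P (preimage B)
  preimage-totallyOrdered em total x y x∈ y∈ with em {P = π x D.≈ π y}
  ... | yes πx≈πy = chain x y πx≈πy
  ... | no  πx≉πy with total (π x) (π y) x∈ y∈
  ...   | inj₁ πx≤πy = inj₁ (Equivalence.from (across x y πx≉πy) πx≤πy)
  ...   | inj₂ πy≤πx = inj₂ (Equivalence.from (across y x (πx≉πy ∘ D.Eq.sym)) πy≤πx)

  preimage-full : ∀ {B} → RespectsEq D B → (∀ x → B (π x) ≡ true) → ∀ i → B i ≡ true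
  preimage-full respects full i =
    let (x , πx≈i) = nonempty i in ≡.trans (≡.sym (respects (π x) i πx≈i)) (full x)

module ChainModuleQuotient (em : ∀ {a} → ExcludedMiddle a) {c ℓ₁ ℓ₂ : Level}
                           (P : Poset c ℓ₁ ℓ₂) where
  open Poset P hiding (refl)
  open ModuleProperties P

  L : Level
  L = c ⊔ ℓ₁ ⊔ ℓ₂

  IsChainModule : Subset P → Set L
  IsChainModule A = IsModule P A × TotallyOrdered P A

  _~_ : Carrier → Carrier → Set L
  x ~ y = Σ (Subset P) λ A → IsChainModule A × A x ≡ true × A y ≡ true

  singleton : Carrier → Subset P
  singleton x v = does (em {P = v ≈ x})

  module _ (x : Carrier) where

    singleton-≈ : ∀ v → singleton x v ≡ true → v ≈ x
    singleton-≈ v v∈ with em {P = v ≈ x}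
    ... | yes v≈x = v≈x

    ≈-singleton : ∀ v → v ≈ x → singleton x v ≡ true
    ≈-singleton v v≈x with em {P = v ≈ x}
    ... | yes _   = refl
    ... | no v≉x = ⊥-elim (v≉x v≈x)

    singleton-isChainModule : IsChainModule (singleton x)
    singleton-isChainModule = (respects , uniform) , total
      where
      respects : RespectsEq P (singleton x)
      respects a b a≈b with em {P = a ≈ x} | em {P = b ≈ x}
      ... | yes _   | yes _   = refl
      ... | no _    | no _    = refl
      ... | yes a≈x | no b≉x = ⊥-elim (b≉x (Eq.trans (Eq.sym a≈b) a≈x))
      ... | no a≉x | yes b≈x = ⊥-elim (a≉x (Eq.trans a≈b b≈x))

      uniform : ∀ v → singleton x v ≡ false → UniformTo P v (singleton x)
      uniform v _ with em {P = v ≤ x} | em {P = x ≤ v}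
      ... | yes v≤x | _ = inj₁ λ a a∈ → ≤-respʳ-≈ (Eq.sym (singleton-≈ a a∈)) v≤x
      ... | no _ | yes x≤v = inj₂ (inj₁ λ a a∈ → ≤-respˡ-≈ (Eq.sym (singleton-≈ a a∈)) x≤v)
      ... | no v≰x | no x≰v = inj₂ (inj₂ λ a a∈ →
        v≰x ∘ ≤-respʳ-≈ (singleton-≈ a a∈) , x≰v ∘ ≤-respˡ-≈ (singleton-≈ a a∈))

      total : TotallyOrdered P (singleton x)
      total a b a∈ b∈ = inj₁ (reflexive (Eq.trans (singleton-≈ a a∈) (Eq.sym (singleton-≈ b b∈))))

  ≈⇒~ : ∀ {x y} → x ≈ y → x ~ y
  ≈⇒~ {x} {y} x≈y =
    singleton x , singleton-isChainModule x , ≈-singleton x x Eq.refl , ≈-singleton x y (Eq.sym x≈y)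

  ~-sym : ∀ {x y} → x ~ y → y ~ x
  ~-sym (A , chainA , x∈A , y∈A) = A , chainA , y∈A , x∈A

  ~-trans : ∀ {x y z} → x ~ y → y ~ z → x ~ z
  ~-trans {z = z} (A , (modA , totA) , x∈A , y∈A) (B , (modB , totB) , y∈B , z∈B) =
    A ∪ B , (∪-isModule em y∈A y∈B modA modB , ∪-totallyOrdered em y∈A y∈B modA totA totB) ,
    ≡.cong (_∨ B _) x∈A , ≡.trans (≡.cong (A z ∨_) z∈B) (∨-zeroʳ (A z))

  _⊑_ : Carrier → Carrier → Set L
  x ⊑ y = x ~ y ⊎ Lift L (x ≤ y)

  ⊑-trans : ∀ {x y z} → x ⊑ y → y ⊑ z → x ⊑ z
  ⊑-trans (inj₁ x~y)        (inj₁ y~z)        = inj₁ (~-trans x~y y~z)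
  ⊑-trans (inj₂ (lift x≤y)) (inj₂ (lift y≤z)) = inj₂ (lift (trans x≤y y≤z))
  ⊑-trans {x} {y} {z} (inj₁ (A , (modA , totA) , x∈A , y∈A)) (inj₂ (lift y≤z))
    with em {P = A z ≡ true}
  ... | yes z∈A = inj₁ (A , (modA , totA) , x∈A , z∈A)
  ... | no  z∉A = inj₂ (lift (above-module modA (¬-not z∉A) y∈A y≤z x x∈A))
  ⊑-trans {x} {y} {z} (inj₂ (lift x≤y)) (inj₁ (A , (modA , totA) , y∈A , z∈A))
    with em {P = A x ≡ true}
  ... | yes x∈A = inj₁ (A , (modA , totA) , x∈A , z∈A)
  ... | no  x∉A = inj₂ (lift (below-module modA (¬-not x∉A) y∈A x≤y z z∈A))

  ⊑-antisym : ∀ {x y} → x ⊑ y → y ⊑ x → x ~ y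
  ⊑-antisym (inj₁ x~y)        _                 = x~y
  ⊑-antisym (inj₂ _)          (inj₁ y~x)        = ~-sym y~x
  ⊑-antisym (inj₂ (lift x≤y)) (inj₂ (lift y≤x)) = ≈⇒~ (antisym x≤y y≤x)

  -- The quotient by ~ is the setoid on P's carrier whose equality is ~; the
  -- carrier is lifted only to reach the universe levels of the statement.
  quotient : Poset L L L
  quotient = record
    { Carrier        = Lift L Carrier
    ; _≈_            = λ i j → lower i ~ lower j
    ; _≤_            = λ i j → lower i ⊑ lower j
    ; isPartialOrder = record
      { isPreorder = record
        { isEquivalence = record { refl = ≈⇒~ Eq.refl ; sym = ~-sym ; trans = ~-trans }
        ; reflexive     = inj₁
        ; trans         = ⊑-trans
        }
      ; antisym = ⊑-antisym
      }
    }

  quotient-isLexSum : IsLexSumOfChains P quotient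
  quotient-isLexSum = record
    { π        = lift
    ; π-cong   = λ _ _ → ≈⇒~
    ; nonempty = λ i → lower i , ≈⇒~ Eq.refl
    ; chain    = λ { x y (A , (_ , totA) , x∈A , y∈A) → totA x y x∈A y∈A }
    ; across   = λ x y x≁y → mk⇔ (inj₂ ∘ lift) λ { (inj₁ x~y) → ⊥-elim (x≁y x~y) ; (inj₂ (lift x≤y)) → x≤y }
    }

  open LexSumPreimage quotient-isLexSum public

  -- The preimage is a chain module, so any two of its points are related,
  -- i.e. equal in the quotient.
  chainPreimage⇒trivial : ∀ {B} → IsModule quotient B → TotallyOrdered P (preimage B) →
                          IsTrivial quotient B
  chainPreimage⇒trivial {B} modB total with em {P = Σ Carrier λ x → B (lift x) ≡ true}
  ... | no  empty    = inj₁ λ i → ¬-not λ i∈B → empty (lower i , i∈B)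
  ... | yes (x , x∈) = inj₂ (inj₁ (lift x , x∈ , λ j j∈ →
    preimage B , (preimage-isModule modB , total) , j∈ , x∈))

mainTheorem19 : (em : ∀ {a} → ExcludedMiddle a) →
    {c ℓ₁ ℓ₂ : Level} (P : Poset c ℓ₁ ℓ₂) →
    Σ (Poset (c ⊔ ℓ₁ ⊔ ℓ₂) (c ⊔ ℓ₁ ⊔ ℓ₂) (c ⊔ ℓ₁ ⊔ ℓ₂)) λ D →
      IsLexSumOfChains P D
      × NoNontrivialChainModule D
      × (ProperModulesTotallyOrdered P → IsPrime D)
mainTheorem19 em P = quotient , quotient-isLexSum , noChainModule , prime
  where
  open ChainModuleQuotient em P

  noChainModule : NoNontrivialChainModule quotient
  noChainModule B modB nontrivial total =
    nontrivial (chainPreimage⇒trivial modB (preimage-totallyOrdered em total))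

  prime : ProperModulesTotallyOrdered P → IsPrime quotient
  prime properChains B modB with em {P = ∀ i → B i ≡ true}
  ... | yes full    = inj₂ (inj₂ full)
  ... | no  notFull = chainPreimage⇒trivial modB
    (properChains (preimage B) (preimage-isModule modB) (notFull ∘ preimage-full (proj₁ modB)))
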